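{- Consider words over the alphabet $\{U,D,R\}$, where $U=(1,1)$, and $D$ and $R$ both denote the step $(1,-1)$ ($R$ being a "red" down-step, representing the south-west step of skew Dyck paths). Call such a word an admissible skew path if the lattice path it describes, starting at $(0,0)$, never goes below the $x$-axis, the word contains no factor $UR$ and no factor $RU$, and every maximal run of consecutive steps from $\{D,R\}$ that ends on the $x$-axis has odd length. Let $r_2=\frac{1+z^2-\sqrt{1-6z^2+5z^4}}{2z}$. Let $h_0$ (resp. $k_0$) be the generating function, with $z$ marking the number of steps, of nonempty admissible skew paths ending on the $x$-axis whose last step is $D$ (resp. $R$). Then $$h_0=-\frac{(z^3-2z+2r_2)\,z}{(z^2-2)(1+z^2)},\qquad k_0=\frac{2\,(-z^3+r_2z^2+2z-r_2)\,z}{(z^2-2)(1+z^2)}.$$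
   Context: The admissible skew paths ending on the $x$-axis are skew Dyck paths (Dyck paths with additional south-west steps and no overlaps, the south-west steps being drawn as red down-steps $R$) satisfying Stanley's restriction that maximal down-runs to the $x$-axis have odd length. -}

module Defs where

open import Data.Nat as ℕ using (ℕ; zero; suc)
open import Data.Integer as ℤ using (ℤ; +_)
open import Data.Bool using (Bool; true; false; _∧_; if_then_else_)
open import Data.List using (List; []; _∷_; map; concatMap; filter; length)
open import Relation.Binary.PropositionalEquality using (_≡_)
open import Relation.Nullary.Decidable using (Dec)
open import Data.Bool.Properties using () renaming (_≟_ to _≟B_)

data Step : Set where
  U D R : Step

isDown : Step → Bool
isDown U = false
isDown D = true
isDown R = true

staysAbove : ℕ → List Step → Bool
staysAbove h [] = true
staysAbove h (U ∷ w) = staysAbove (suc h) w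
staysAbove zero (D ∷ w) = false
staysAbove (suc h) (D ∷ w) = staysAbove h w
staysAbove zero (R ∷ w) = false
staysAbove (suc h) (R ∷ w) = staysAbove h w

-- final height (meaningful when staysAbove 0 w holds)
endHeight : ℕ → List Step → ℕ
endHeight h [] = h
endHeight h (U ∷ w) = endHeight (suc h) w
endHeight h (D ∷ w) = endHeight (h ℕ.∸ 1) w
endHeight h (R ∷ w) = endHeight (h ℕ.∸ 1) w

noUR-RU : List Step → Bool
noUR-RU [] = true
noUR-RU (U ∷ R ∷ w) = false
noUR-RU (R ∷ U ∷ w) = false
noUR-RU (x ∷ w) = noUR-RU w

isZero : ℕ → Bool
isZero zero = true
isZero (suc _) = false

odd : ℕ → Bool
odd zero = false
odd (suc zero) = true
odd (suc (suc n)) = odd n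

-- A maximal run of down-steps (from {D,R}) of length k that has just
-- ended at height h: it is acceptable unless it ends on the x-axis with
-- even length.  (k = 0 means "no run", always acceptable.)
runOK : ℕ → ℕ → Bool
runOK h zero = true
runOK h (suc k) = if isZero h then odd (suc k) else true

oddRuns : ℕ → ℕ → List Step → Bool
oddRuns h k [] = runOK h k
oddRuns h k (U ∷ w) = runOK h k ∧ oddRuns (suc h) 0 w
oddRuns h k (D ∷ w) = oddRuns (h ℕ.∸ 1) (suc k) w
oddRuns h k (R ∷ w) = oddRuns (h ℕ.∸ 1) (suc k) w

admissible : List Step → Bool
admissible w = staysAbove 0 w ∧ noUR-RU w ∧ oddRuns 0 0 w

lastIs : Step → List Step → Bool
lastIs s [] = false
lastIs U (U ∷ []) = true
lastIs D (D ∷ []) = true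
lastIs R (R ∷ []) = true
lastIs s (x ∷ []) = false
lastIs s (x ∷ y ∷ w) = lastIs s (y ∷ w)

-- nonempty admissible skew path ending on the x-axis with last step s
-- (nonemptiness is implied by lastIs)
counted : Step → List Step → Bool
counted s w = admissible w ∧ isZero (endHeight 0 w) ∧ lastIs s w

words : ℕ → List (List Step)
words zero = [] ∷ []
words (suc n) = concatMap (λ w → (U ∷ w) ∷ (D ∷ w) ∷ (R ∷ w) ∷ []) (words n)

countWith : Step → ℕ → ℕ
countWith s n = length (filter (λ w → counted s w ≟B true) (words n))

FPS : Set
FPS = ℕ → ℤ

infix 4 _≈_
_≈_ : FPS → FPS → Set
f ≈ g = ∀ n → f n ≡ g n

infixl 6 _⊕_ _⊖_
infixl 7 _⊛_

_⊕_ : FPS → FPS → FPS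
(f ⊕ g) n = f n ℤ.+ g n

⊝_ : FPS → FPS
(⊝ f) n = ℤ.- f n

_⊖_ : FPS → FPS → FPS
f ⊖ g = f ⊕ (⊝ g)

convAux : FPS → FPS → ℕ → ℕ → ℤ
convAux f g n zero = f 0 ℤ.* g n
convAux f g n (suc i) = f (suc i) ℤ.* g (n ℕ.∸ suc i) ℤ.+ convAux f g n i

_⊛_ : FPS → FPS → FPS
(f ⊛ g) n = convAux f g n n

const : ℤ → FPS
const c zero = c
const c (suc _) = + 0

Z : FPS
Z (suc zero) = + 1
Z _ = + 0

h₀ k₀ : FPS
h₀ n = + countWith D n
k₀ n = + countWith R n

-- Read a word from left to right, remembering its height and whether its last step was U or
-- closed a down-run of a given colour and parity: the admissibility conditions then only look at
-- this state. Cutting paths at their first visit to each lower level expresses every generating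
-- function through the first-passage series P⁰, P¹, Q⁰, Q¹ from height 2 down to the axis (by the
-- colour and parity of the final run), which satisfy a quadratic system. Its solution has Q = P and
-- makes r = Z (2 + P⁰ + P¹) a power-series root of Z X² − (1 + Z²) X + 2Z − Z³, as r₂ is by its
-- definition; the other root has a pole at 0, so r₂ = r. Finally h₀ and k₀ are rational in Z
-- and P¹, and the system turns them into the stated formulas.

module Submission where

open import Defs
open import Algebra.Bundles using (CommutativeRing)
open import Algebra.Structures using (IsCommutativeRing)
open import Algebra.Solver.Ring.AlmostCommutativeRing
  using (_-Raw-AlmostCommutative⟶_; fromCommutativeRing)
open import Data.Bool using (Bool; true; false; not; _∧_)
open import Data.Bool.Properties using (∧-zeroʳ; ∧-assoc) renaming (_≟_ to _≟ᵇ_)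
open import Data.Integer as ℤ using (ℤ; +_; 0ℤ; 1ℤ; _+_; _*_; -_)
import Data.Integer.Properties as ℤₚ
open import Data.Integer.Tactic.RingSolver using (solve-∀)
open import Data.List using (List; []; _∷_; _++_; concatMap; filter; length)
open import Data.Maybe using (Maybe; just; nothing)
open import Data.Nat as ℕ using (ℕ; zero; suc; _≤_; _<_; z≤n; s≤s)
open import Data.Nat.Induction using (<-rec)
import Data.Nat.Properties as ℕₚ
open import Data.Product using (_×_; _,_)
open import Data.Sum using ([_,_]′)
open import Function using (id; _∘_)
open import Level using (0ℓ)
open import Relation.Binary.PropositionalEquality
open import Relation.Nullary using (yes; no; contradiction)
open import Algebra.Properties.CommutativeSemigroup ℤₚ.+-commutativeSemigroup
  using () renaming (interchange to +-interchange)
open ≡-Reasoning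

tail : FPS → FPS
tail f n = f (suc n)

-- The Cauchy product recursing on the first factor; _⊛_ adds up the same terms backwards.
cauchy : FPS → FPS → FPS
cauchy f g zero    = f 0 * g 0
cauchy f g (suc n) = f 0 * g (suc n) + cauchy (tail f) g n

convAux-suc : ∀ f g n i →
  convAux f g (suc n) (suc i) ≡ convAux (tail f) g n i + f 0 * g (suc n)
convAux-suc f g n zero    = refl
convAux-suc f g n (suc i) = begin
  f (2 ℕ.+ i) * g (n ℕ.∸ suc i) + convAux f g (suc n) (suc i)
    ≡⟨ cong (_+_ (f (2 ℕ.+ i) * g (n ℕ.∸ suc i))) (convAux-suc f g n i) ⟩
  f (2 ℕ.+ i) * g (n ℕ.∸ suc i) + (convAux (tail f) g n i + f 0 * g (suc n))
    ≡⟨ ℤₚ.+-assoc (f (2 ℕ.+ i) * g (n ℕ.∸ suc i)) _ _ ⟨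
  convAux (tail f) g n (suc i) + f 0 * g (suc n) ∎

⊛≗cauchy : ∀ f g → f ⊛ g ≈ cauchy f g
⊛≗cauchy f g zero    = refl
⊛≗cauchy f g (suc n) = begin
  convAux f g (suc n) (suc n)            ≡⟨ convAux-suc f g n n ⟩
  convAux (tail f) g n n + f 0 * g (suc n) ≡⟨ cong (_+ f 0 * g (suc n)) (⊛≗cauchy (tail f) g n) ⟩
  cauchy (tail f) g n + f 0 * g (suc n)  ≡⟨ ℤₚ.+-comm (cauchy (tail f) g n) _ ⟩
  cauchy f g (suc n)                     ∎

cauchy-cong : ∀ {f f′ g g′} → f ≈ f′ → g ≈ g′ → cauchy f g ≈ cauchy f′ g′
cauchy-cong f≈f′ g≈g′ zero    = cong₂ _*_ (f≈f′ 0) (g≈g′ 0)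
cauchy-cong f≈f′ g≈g′ (suc n) =
  cong₂ _+_ (cong₂ _*_ (f≈f′ 0) (g≈g′ (suc n))) (cauchy-cong (λ i → f≈f′ (suc i)) g≈g′ n)

cauchy-congˡ : ∀ {f f′} → f ≈ f′ → ∀ g → cauchy f g ≈ cauchy f′ g
cauchy-congˡ f≈f′ g = cauchy-cong f≈f′ (λ _ → refl)

cauchy-zeroʳ-≤ : ∀ n {f g} → (∀ {i} → i ≤ n → g i ≡ 0ℤ) → cauchy f g n ≡ 0ℤ
cauchy-zeroʳ-≤ zero    {f} g≡0 = trans (cong (f 0 *_) (g≡0 z≤n)) (ℤₚ.*-zeroʳ (f 0))
cauchy-zeroʳ-≤ (suc n) {f} g≡0 = cong₂ _+_
  (trans (cong (f 0 *_) (g≡0 ℕₚ.≤-refl)) (ℤₚ.*-zeroʳ (f 0)))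
  (cauchy-zeroʳ-≤ n (λ i≤n → g≡0 (ℕₚ.m≤n⇒m≤1+n i≤n)))

cauchy-sucʳ : ∀ f g n → cauchy f g (suc n) ≡ cauchy f (tail g) n + f (suc n) * g 0
cauchy-sucʳ f g zero    = refl
cauchy-sucʳ f g (suc n) = begin
  f 0 * g (2 ℕ.+ n) + cauchy (tail f) g (suc n)
    ≡⟨ cong (_+_ (f 0 * g (2 ℕ.+ n))) (cauchy-sucʳ (tail f) g n) ⟩
  f 0 * g (2 ℕ.+ n) + (cauchy (tail f) (tail g) n + f (2 ℕ.+ n) * g 0)
    ≡⟨ ℤₚ.+-assoc (f 0 * g (2 ℕ.+ n)) _ _ ⟨
  cauchy f (tail g) (suc n) + f (2 ℕ.+ n) * g 0 ∎

cauchy-comm : ∀ f g → cauchy f g ≈ cauchy g f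
cauchy-comm f g zero    = ℤₚ.*-comm (f 0) (g 0)
cauchy-comm f g (suc n) = begin
  f 0 * g (suc n) + cauchy (tail f) g n ≡⟨ cong₂ _+_ (ℤₚ.*-comm (f 0) (g (suc n))) (cauchy-comm (tail f) g n) ⟩
  g (suc n) * f 0 + cauchy g (tail f) n ≡⟨ ℤₚ.+-comm (g (suc n) * f 0) _ ⟩
  cauchy g (tail f) n + g (suc n) * f 0 ≡⟨ cauchy-sucʳ g f n ⟨
  cauchy g f (suc n)                    ∎

cauchy-zeroˡ : ∀ {f} g → (∀ i → f i ≡ 0ℤ) → ∀ n → cauchy f g n ≡ 0ℤ
cauchy-zeroˡ {f} g f≡0 n = trans (cauchy-comm f g n) (cauchy-zeroʳ-≤ n (λ {i} _ → f≡0 i))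

cauchy-constˡ : ∀ c g n → cauchy (const c) g n ≡ c * g n
cauchy-constˡ c g zero    = refl
cauchy-constˡ c g (suc n) = begin
  c * g (suc n) + cauchy (tail (const c)) g n ≡⟨ cong (_+_ (c * g (suc n))) (cauchy-zeroˡ g (λ _ → refl) n) ⟩
  c * g (suc n) + 0ℤ                          ≡⟨ ℤₚ.+-identityʳ _ ⟩
  c * g (suc n)                               ∎

cauchy-distribʳ : ∀ f g h → cauchy (f ⊕ g) h ≈ cauchy f h ⊕ cauchy g h
cauchy-distribʳ f g h zero    = ℤₚ.*-distribʳ-+ (h 0) (f 0) (g 0)
cauchy-distribʳ f g h (suc n) = begin
  (f 0 + g 0) * h (suc n) + cauchy (tail f ⊕ tail g) h n
    ≡⟨ cong₂ _+_ (ℤₚ.*-distribʳ-+ (h (suc n)) (f 0) (g 0)) (cauchy-distribʳ (tail f) (tail g) h n) ⟩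
  (f 0 * h (suc n) + g 0 * h (suc n)) + (cauchy (tail f) h n + cauchy (tail g) h n)
    ≡⟨ +-interchange (f 0 * h (suc n)) _ _ _ ⟩
  cauchy f h (suc n) + cauchy g h (suc n) ∎

cauchy-scaleˡ : ∀ c f g → cauchy (λ i → c * f i) g ≈ λ n → c * cauchy f g n
cauchy-scaleˡ c f g zero    = ℤₚ.*-assoc c (f 0) (g 0)
cauchy-scaleˡ c f g (suc n) = begin
  c * f 0 * g (suc n) + cauchy (λ i → c * tail f i) g n
    ≡⟨ cong₂ _+_ (ℤₚ.*-assoc c (f 0) (g (suc n))) (cauchy-scaleˡ c (tail f) g n) ⟩
  c * (f 0 * g (suc n)) + c * cauchy (tail f) g n
    ≡⟨ ℤₚ.*-distribˡ-+ c (f 0 * g (suc n)) _ ⟨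
  c * cauchy f g (suc n) ∎

cauchy-assoc : ∀ f g h → cauchy (cauchy f g) h ≈ cauchy f (cauchy g h)
cauchy-assoc f g h zero    = ℤₚ.*-assoc (f 0) (g 0) (h 0)
cauchy-assoc f g h (suc n) = begin
  f 0 * g 0 * h (suc n) + cauchy (tail (cauchy f g)) h n
    ≡⟨ cong (_+_ (f 0 * g 0 * h (suc n))) (cauchy-distribʳ (λ i → f 0 * tail g i) (cauchy (tail f) g) h n) ⟩
  f 0 * g 0 * h (suc n) + (cauchy (λ i → f 0 * tail g i) h n + cauchy (cauchy (tail f) g) h n)
    ≡⟨ cong₂ (λ x y → f 0 * g 0 * h (suc n) + (x + y)) (cauchy-scaleˡ (f 0) (tail g) h n) (cauchy-assoc (tail f) g h n) ⟩
  f 0 * g 0 * h (suc n) + (f 0 * cauchy (tail g) h n + cauchy (tail f) (cauchy g h) n)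
    ≡⟨ regroup (f 0) (g 0) (h (suc n)) _ _ ⟩
  f 0 * (g 0 * h (suc n) + cauchy (tail g) h n) + cauchy (tail f) (cauchy g h) n ∎
  where
  regroup : ∀ a b c d e → a * b * c + (a * d + e) ≡ a * (b * c + d) + e
  regroup = solve-∀

infix 4 _≋_
-- _≈_ unfolds to a Π-type from which its arguments cannot be inferred; the record keeps them visible.
record _≋_ (f g : FPS) : Set where
  constructor ≈⇒≋
  field ≋⇒≈ : f ≈ g
open _≋_ public

≋-refl : ∀ {f} → f ≋ f
≋-refl = ≈⇒≋ λ _ → refl

≋-sym : ∀ {f g} → f ≋ g → g ≋ f
≋-sym (≈⇒≋ p) = ≈⇒≋ λ n → sym (p n)

≋-trans : ∀ {f g h} → f ≋ g → g ≋ h → f ≋ h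
≋-trans (≈⇒≋ p) (≈⇒≋ q) = ≈⇒≋ λ n → trans (p n) (q n)

0# 1# : FPS
0# = const 0ℤ
1# = const 1ℤ

0#≡0 : ∀ n → 0# n ≡ 0ℤ
0#≡0 zero    = refl
0#≡0 (suc n) = refl

⊛-cong : ∀ {f f′ g g′} → f ≋ f′ → g ≋ g′ → f ⊛ g ≋ f′ ⊛ g′
⊛-cong {f} {f′} {g} {g′} (≈⇒≋ p) (≈⇒≋ q) = ≈⇒≋ λ n → begin
  (f ⊛ g) n     ≡⟨ ⊛≗cauchy f g n ⟩
  cauchy f g n   ≡⟨ cauchy-cong p q n ⟩
  cauchy f′ g′ n ≡⟨ ⊛≗cauchy f′ g′ n ⟨
  (f′ ⊛ g′) n   ∎

⊛-comm : ∀ f g → f ⊛ g ≋ g ⊛ f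
⊛-comm f g = ≈⇒≋ λ n → begin
  (f ⊛ g) n    ≡⟨ ⊛≗cauchy f g n ⟩
  cauchy f g n ≡⟨ cauchy-comm f g n ⟩
  cauchy g f n ≡⟨ ⊛≗cauchy g f n ⟨
  (g ⊛ f) n    ∎

⊛-assoc : ∀ f g h → (f ⊛ g) ⊛ h ≋ f ⊛ (g ⊛ h)
⊛-assoc f g h = ≈⇒≋ λ n → begin
  ((f ⊛ g) ⊛ h) n          ≡⟨ ⊛≗cauchy (f ⊛ g) h n ⟩
  cauchy (f ⊛ g) h n        ≡⟨ cauchy-cong (⊛≗cauchy f g) (λ _ → refl) n ⟩
  cauchy (cauchy f g) h n   ≡⟨ cauchy-assoc f g h n ⟩
  cauchy f (cauchy g h) n   ≡⟨ cauchy-cong (λ _ → refl) (⊛≗cauchy g h) n ⟨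
  cauchy f (g ⊛ h) n        ≡⟨ ⊛≗cauchy f (g ⊛ h) n ⟨
  (f ⊛ (g ⊛ h)) n          ∎

const⊛ : ∀ c g n → (const c ⊛ g) n ≡ c * g n
const⊛ c g n = trans (⊛≗cauchy (const c) g n) (cauchy-constˡ c g n)

⊛-identityˡ : ∀ g → 1# ⊛ g ≋ g
⊛-identityˡ g = ≈⇒≋ λ n → trans (const⊛ 1ℤ g n) (ℤₚ.*-identityˡ (g n))

⊛-distribʳ : ∀ h f g → (f ⊕ g) ⊛ h ≋ f ⊛ h ⊕ g ⊛ h
⊛-distribʳ h f g = ≈⇒≋ λ n → begin
  ((f ⊕ g) ⊛ h) n              ≡⟨ ⊛≗cauchy (f ⊕ g) h n ⟩
  cauchy (f ⊕ g) h n            ≡⟨ cauchy-distribʳ f g h n ⟩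
  cauchy f h n + cauchy g h n   ≡⟨ cong₂ _+_ (⊛≗cauchy f h n) (⊛≗cauchy g h n) ⟨
  (f ⊛ h ⊕ g ⊛ h) n            ∎

⊕-cong : ∀ {f f′ g g′} → f ≋ f′ → g ≋ g′ → f ⊕ g ≋ f′ ⊕ g′
⊕-cong (≈⇒≋ p) (≈⇒≋ q) = ≈⇒≋ λ n → cong₂ _+_ (p n) (q n)

fps-isCommutativeRing : IsCommutativeRing _≋_ _⊕_ _⊛_ ⊝_ 0# 1#
fps-isCommutativeRing = record
  { isRing = record
    { +-isAbelianGroup = record
      { isGroup = record
        { isMonoid = record
          { isSemigroup = record
            { isMagma = record
              { isEquivalence = record { refl = ≋-refl ; sym = ≋-sym ; trans = ≋-trans }
              ; ∙-cong = ⊕-cong }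
            ; assoc = λ f g h → ≈⇒≋ λ n → ℤₚ.+-assoc (f n) (g n) (h n) }
          ; identity = (λ f → ≈⇒≋ λ n → trans (cong (_+ f n) (0#≡0 n)) (ℤₚ.+-identityˡ (f n)))
                     , (λ f → ≈⇒≋ λ n → trans (cong (_+_ (f n)) (0#≡0 n)) (ℤₚ.+-identityʳ (f n))) }
        ; inverse = (λ f → ≈⇒≋ λ n → trans (ℤₚ.+-inverseˡ (f n)) (sym (0#≡0 n)))
                  , (λ f → ≈⇒≋ λ n → trans (ℤₚ.+-inverseʳ (f n)) (sym (0#≡0 n)))
        ; ⁻¹-cong = λ (≈⇒≋ p) → ≈⇒≋ λ n → cong -_ (p n) }
      ; comm = λ f g → ≈⇒≋ λ n → ℤₚ.+-comm (f n) (g n) }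
    ; *-cong = ⊛-cong
    ; *-assoc = ⊛-assoc
    ; *-identity = ⊛-identityˡ , λ g → ≋-trans (⊛-comm g 1#) (⊛-identityˡ g)
    ; distrib = (λ h f g → ≋-trans (⊛-comm h (f ⊕ g))
                  (≋-trans (⊛-distribʳ h f g) (⊕-cong (⊛-comm f h) (⊛-comm g h))))
              , ⊛-distribʳ }
  ; *-comm = ⊛-comm }

fps-commutativeRing : CommutativeRing 0ℓ 0ℓ
fps-commutativeRing = record { isCommutativeRing = fps-isCommutativeRing }

const-homomorphism : ℤ.+-*-rawRing -Raw-AlmostCommutative⟶ fromCommutativeRing fps-commutativeRing
const-homomorphism = record
  { ⟦_⟧    = const
  ; +-homo = λ a b → ≈⇒≋ λ { zero → refl ; (suc n) → refl }
  ; *-homo = λ a b → ≈⇒≋ λ { zero → refl ; (suc n) → sym (trans (const⊛ a (const b) (suc n)) (ℤₚ.*-zeroʳ a)) }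
  ; -‿homo = λ a → ≈⇒≋ λ { zero → refl ; (suc n) → refl }
  ; 0-homo = ≈⇒≋ λ { zero → refl ; (suc n) → refl }
  ; 1-homo = ≈⇒≋ λ { zero → refl ; (suc n) → refl } }

const-≟ : ∀ a b → Maybe (const a ≋ const b)
const-≟ a b with a ℤ.≟ b
... | yes refl = just ≋-refl
... | no _     = nothing

open import Algebra.Solver.Ring ℤ.+-*-rawRing (fromCommutativeRing fps-commutativeRing) const-homomorphism const-≟

Z⊛-suc : ∀ g n → (Z ⊛ g) (suc n) ≡ g n
Z⊛-suc g n = begin
  (Z ⊛ g) (suc n)          ≡⟨ ⊛≗cauchy Z g (suc n) ⟩
  0ℤ + cauchy (tail Z) g n ≡⟨ ℤₚ.+-identityˡ _ ⟩
  cauchy (tail Z) g n      ≡⟨ cauchy-congˡ tail-Z≈1# g n ⟩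
  cauchy 1# g n            ≡⟨ cauchy-constˡ 1ℤ g n ⟩
  1ℤ * g n                 ≡⟨ ℤₚ.*-identityˡ (g n) ⟩
  g n                      ∎
  where
  tail-Z≈1# : tail Z ≈ 1#
  tail-Z≈1# zero    = refl
  tail-Z≈1# (suc n) = refl

Z⊛-unshift : ∀ {f g} → f 0 ≡ 0ℤ → (∀ n → f (suc n) ≡ g n) → f ≋ Z ⊛ g
Z⊛-unshift {f} {g} f₀≡0 f′≈g = ≈⇒≋ λ { zero → f₀≡0 ; (suc n) → trans (f′≈g n) (sym (Z⊛-suc g n)) }

Z⊛X≋0⇒X≋0 : ∀ {X} → Z ⊛ X ≋ 0# → X ≋ 0#
Z⊛X≋0⇒X≋0 {X} (≈⇒≋ ZX≈0) = ≈⇒≋ λ n → trans (sym (Z⊛-suc X n)) (trans (ZX≈0 (suc n)) (sym (0#≡0 n)))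

u⊛X≋0⇒X≋0 : ∀ {u X} → u 0 ≢ 0ℤ → u ⊛ X ≋ 0# → X ≋ 0#
u⊛X≋0⇒X≋0 {u} {X} u₀≢0 (≈⇒≋ uX≈0) = ≈⇒≋ λ n → trans (X≡0 n) (sym (0#≡0 n))
  where
  uX≡0 : ∀ n → cauchy u X n ≡ 0ℤ
  uX≡0 n = trans (sym (⊛≗cauchy u X n)) (trans (uX≈0 n) (0#≡0 n))

  leading-term : ∀ n → (∀ {i} → i < n → X i ≡ 0ℤ) → u 0 * X n ≡ 0ℤ
  leading-term zero    _     = uX≡0 0
  leading-term (suc m) X<≡0 = begin
    u 0 * X (suc m)      ≡⟨ ℤₚ.+-identityʳ _ ⟨
    u 0 * X (suc m) + 0ℤ ≡⟨ cong (_+_ (u 0 * X (suc m))) (cauchy-zeroʳ-≤ m (λ i≤m → X<≡0 (s≤s i≤m))) ⟨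
    cauchy u X (suc m)   ≡⟨ uX≡0 (suc m) ⟩
    0ℤ                   ∎

  X≡0 : ∀ n → X n ≡ 0ℤ
  X≡0 = <-rec _ λ n X<≡0 →
    [ (λ u₀≡0 → contradiction u₀≡0 u₀≢0) , id ]′ (ℤₚ.i*j≡0⇒i≡0∨j≡0 (u 0) (leading-term n X<≡0))

infixr 5 _·_∷_
data LinearCombination : FPS → Set where
  []    : LinearCombination 0#
  _·_∷_ : ∀ {P Q E} (c : FPS) → P ≋ Q → LinearCombination E → LinearCombination (c ⊛ (P ⊖ Q) ⊕ E)

linear-combination-≋0 : ∀ {E} → LinearCombination E → E ≋ 0#
linear-combination-≋0 []                                 = ≋-refl
linear-combination-≋0 (_·_∷_ {P} {Q} {E} c (≈⇒≋ P≈Q) lc) = ≈⇒≋ λ n → begin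
  (c ⊛ (P ⊖ Q)) n + E n ≡⟨ cong₂ _+_ (c[P-Q]≡0 n) (≋⇒≈ (linear-combination-≋0 lc) n) ⟩
  0ℤ + 0# n              ≡⟨ ℤₚ.+-identityˡ (0# n) ⟩
  0# n                   ∎
  where
  c[P-Q]≡0 : ∀ n → (c ⊛ (P ⊖ Q)) n ≡ 0ℤ
  c[P-Q]≡0 n = trans (⊛≗cauchy c (P ⊖ Q) n) (cauchy-zeroʳ-≤ n (λ {i} _ → ℤₚ.i≡j⇒i-j≡0 (P≈Q i)))

≋0⇒≋ : ∀ {A B} → A ⊖ B ≋ 0# → A ≋ B
≋0⇒≋ {A} {B} (≈⇒≋ A-B≈0) = ≈⇒≋ λ n → ℤₚ.i-j≡0⇒i≡j (A n) (B n) (trans (A-B≈0 n) (0#≡0 n))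

linear-combination : ∀ {A B E} → LinearCombination E → A ⊖ B ≋ E → A ≋ B
linear-combination lc A-B≋E = ≋0⇒≋ (≋-trans A-B≋E (linear-combination-≋0 lc))

cancel-linear-combination : ∀ {A B E} u → u 0 ≢ 0ℤ → LinearCombination E → u ⊛ (A ⊖ B) ≋ E → A ≋ B
cancel-linear-combination u u₀≢0 lc u[A-B]≋E =
  ≋0⇒≋ (u⊛X≋0⇒X≋0 u₀≢0 (≋-trans u[A-B]≋E (linear-combination-≋0 lc)))

data Colour : Set where
  plain red : Colour

step : Colour → Step
step plain = D
step red   = R

-- The state after the steps read so far: the last step was U, or it ended a
-- down-run of the given colour whose length has the given parity (true = odd).
data State : Set where
  rising  : State
  falling : Colour → Bool → State

allowsUp : State → Bool
allowsUp (falling red _) = false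
allowsUp _               = true

allowsRed : State → Bool
allowsRed rising        = false
allowsRed (falling _ _) = true

runParity : State → Bool
runParity rising        = false
runParity (falling _ p) = p

fall : Colour → State → State
fall c s = falling c (not (runParity s))

_==ᶜ_ : Colour → Colour → Bool
plain ==ᶜ plain = true
red   ==ᶜ red   = true
_     ==ᶜ _     = false

-- Matching on the second argument makes `p ==ᵇ true` reduce to p.
_==ᵇ_ : Bool → Bool → Bool
p ==ᵇ true  = p
p ==ᵇ false = not p

_==_ : State → State → Bool
rising      == rising        = true
falling c p == falling c′ p′ = (p ==ᵇ p′) ∧ (c ==ᶜ c′)
_           == _             = false

-- What a path may do on the x-axis; away from it the moves are fixed by the state.
record Floor : Set where
  field
    rises : State → Bool
    stops : State → Bool
open Floor

𝟙 : Bool → ℤ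
𝟙 true  = 1ℤ
𝟙 false = 0ℤ

paths : Floor → ℕ → ℕ → State → ℤ
paths F zero    zero    s = 𝟙 (stops F s)
paths F zero    (suc h) s = 0ℤ
paths F (suc n) zero    s = 𝟙 (rises F s) * paths F n 1 rising
paths F (suc n) (suc h) s = 𝟙 (allowsUp s) * paths F n (2 ℕ.+ h) rising
                          + paths F n h (fall plain s)
                          + 𝟙 (allowsRed s) * paths F n h (fall red s)

pathSeries : Floor → ℕ → State → FPS
pathSeries F h s n = paths F n h s

-- Paths that end at their first visit to the axis, in state τ.
toAxis : State → Floor
toAxis τ = record { rises = λ _ → false ; stops = _== τ }

passage : State → ℕ → State → FPS
passage τ = pathSeries (toAxis τ)

sumFalling : {A : Set} → (A → A → A) → (State → A) → A
sumFalling _∙_ f = ((f (falling plain false) ∙ f (falling plain true)) ∙ f (falling red false)) ∙ f (falling red true)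

private
  only₁ : ∀ a → 1ℤ * a + 0ℤ + 0ℤ + 0ℤ ≡ a
  only₁ = solve-∀
  only₂ : ∀ a → 0ℤ + 1ℤ * a + 0ℤ + 0ℤ ≡ a
  only₂ = solve-∀
  only₃ : ∀ a → 0ℤ + 0ℤ + 1ℤ * a + 0ℤ ≡ a
  only₃ = solve-∀
  only₄ : ∀ a → 0ℤ + 0ℤ + 0ℤ + 1ℤ * a ≡ a
  only₄ = solve-∀

sumFalling-δ : ∀ c p (G : State → ℤ) → sumFalling _+_ (λ τ → 𝟙 (falling c p == τ) * G τ) ≡ G (falling c p)
sumFalling-δ plain false G = only₁ (G (falling plain false))
sumFalling-δ plain true  G = only₂ (G (falling plain true))
sumFalling-δ red   false G = only₃ (G (falling red false))
sumFalling-δ red   true  G = only₄ (G (falling red true))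

passage-zero : ∀ τ s → passage τ 0 s ≈ const (𝟙 (s == τ))
passage-zero τ s zero    = refl
passage-zero τ s (suc n) = refl

sumFalling-cong : ∀ {f g : State → ℤ} → (∀ τ → f τ ≡ g τ) → sumFalling _+_ f ≡ sumFalling _+_ g
sumFalling-cong f≡g = cong₂ _+_ (cong₂ _+_ (cong₂ _+_ (f≡g _) (f≡g _)) (f≡g _)) (f≡g _)

module _ (F : Floor) (h : ℕ) where
  private
    B : State → FPS
    B = pathSeries F h

  passage-tail : ∀ τ r s n →
    cauchy (tail (passage τ (suc r) s)) (B τ) n
      ≡ 𝟙 (allowsUp s) * cauchy (passage τ (2 ℕ.+ r) rising) (B τ) n
      + cauchy (passage τ r (fall plain s)) (B τ) n
      + 𝟙 (allowsRed s) * cauchy (passage τ r (fall red s)) (B τ) n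
  passage-tail τ r s n = begin
    cauchy (up ⊕ down plain ⊕ (λ i → 𝟙 (allowsRed s) * down red i)) (B τ) n
      ≡⟨ cauchy-distribʳ (up ⊕ down plain) _ (B τ) n ⟩
    cauchy (up ⊕ down plain) (B τ) n + cauchy (λ i → 𝟙 (allowsRed s) * down red i) (B τ) n
      ≡⟨ cong₂ _+_ (cauchy-distribʳ up (down plain) (B τ) n) (cauchy-scaleˡ (𝟙 (allowsRed s)) (down red) (B τ) n) ⟩
    cauchy up (B τ) n + cauchy (down plain) (B τ) n + 𝟙 (allowsRed s) * cauchy (down red) (B τ) n
      ≡⟨ cong (λ x → x + cauchy (down plain) (B τ) n + 𝟙 (allowsRed s) * cauchy (down red) (B τ) n)
              (cauchy-scaleˡ (𝟙 (allowsUp s)) (passage τ (2 ℕ.+ r) rising) (B τ) n) ⟩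
    _ ∎
    where
    up : FPS
    up i = 𝟙 (allowsUp s) * passage τ (2 ℕ.+ r) rising i
    down : Colour → FPS
    down c = passage τ r (fall c s)

  decompose-here : ∀ n c p → paths F n h (falling c p) ≡ sumFalling _+_ (λ τ → cauchy (passage τ 0 (falling c p)) (B τ) n)
  decompose-here n c p = begin
    paths F n h s
      ≡⟨ sumFalling-δ c p (λ τ → B τ n) ⟨
    sumFalling _+_ (λ τ → 𝟙 (s == τ) * B τ n)
      ≡⟨ sumFalling-cong (λ τ → cauchy-constˡ (𝟙 (s == τ)) (B τ) n) ⟨
    sumFalling _+_ (λ τ → cauchy (const (𝟙 (s == τ))) (B τ) n)
      ≡⟨ sumFalling-cong (λ τ → cauchy-congˡ (passage-zero τ s) (B τ) n) ⟨
    sumFalling _+_ (λ τ → cauchy (passage τ 0 s) (B τ) n) ∎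
    where
    s : State
    s = falling c p

  -- Cut a path from height h + r + 1 at its first visit to height h.
  decompose : ∀ n r s → paths F n (suc r ℕ.+ h) s ≡ sumFalling _+_ (λ τ → cauchy (passage τ (suc r) s) (B τ) n)
  decompose zero    r s = refl
  decompose (suc n) r s = begin
    𝟙 u * paths F n (2 ℕ.+ r ℕ.+ h) rising + paths F n (r ℕ.+ h) (fall plain s) + 𝟙 v * paths F n (r ℕ.+ h) (fall red s)
      ≡⟨ cong₂ _+_ (cong₂ _+_ (cong (𝟙 u *_) (decompose n (suc r) rising)) (after-fall r plain))
                    (cong (𝟙 v *_) (after-fall r red)) ⟩
    𝟙 u * Σ X + Σ (Y plain) + 𝟙 v * Σ (Y red)
      ≡⟨ regroup (𝟙 u) (𝟙 v) (X _) (X _) (X _) (X _) (Y plain _) (Y plain _) (Y plain _) (Y plain _)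
                 (Y red _) (Y red _) (Y red _) (Y red _) ⟩
    Σ (λ τ → 0ℤ + (𝟙 u * X τ + Y plain τ + 𝟙 v * Y red τ))
      ≡⟨ sumFalling-cong (λ τ → cong (_+_ 0ℤ) (passage-tail τ r s n)) ⟨
    Σ (λ τ → cauchy (passage τ (suc r) s) (B τ) (suc n)) ∎
    where
    u v : Bool
    u = allowsUp s
    v = allowsRed s
    Σ : (State → ℤ) → ℤ
    Σ = sumFalling _+_
    X : State → ℤ
    X τ = cauchy (passage τ (2 ℕ.+ r) rising) (B τ) n
    Y : Colour → State → ℤ
    Y c τ = cauchy (passage τ r (fall c s)) (B τ) n
    after-fall : ∀ r c → paths F n (r ℕ.+ h) (fall c s) ≡ Σ (λ τ → cauchy (passage τ r (fall c s)) (B τ) n)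
    after-fall zero    c = decompose-here n c _
    after-fall (suc r) c = decompose n r (fall c s)
    regroup : ∀ u v x₁ x₂ x₃ x₄ y₁ y₂ y₃ y₄ w₁ w₂ w₃ w₄ →
      u * (x₁ + x₂ + x₃ + x₄) + (y₁ + y₂ + y₃ + y₄) + v * (w₁ + w₂ + w₃ + w₄)
        ≡ 0ℤ + (u * x₁ + y₁ + v * w₁) + (0ℤ + (u * x₂ + y₂ + v * w₂))
        + (0ℤ + (u * x₃ + y₃ + v * w₃)) + (0ℤ + (u * x₄ + y₄ + v * w₄))
    regroup = solve-∀

pathSeries-split : ∀ F h s → pathSeries F (suc h) s ≋ sumFalling _⊕_ (λ τ → passage τ 1 s ⊛ pathSeries F h τ)
pathSeries-split F h s = ≈⇒≋ λ n →
  trans (decompose F h n 0 s) (sym (sumFalling-cong (λ τ → ⊛≗cauchy (passage τ 1 s) (pathSeries F h τ) n)))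

pathSeries-suc : ∀ F h s → pathSeries F (suc h) s ≋
  Z ⊛ (const (𝟙 (allowsUp s)) ⊛ pathSeries F (2 ℕ.+ h) rising
       ⊕ pathSeries F h (fall plain s)
       ⊕ const (𝟙 (allowsRed s)) ⊛ pathSeries F h (fall red s))
pathSeries-suc F h s = Z⊛-unshift refl λ n →
  sym (cong₂ _+_ (cong (_+ paths F n h (fall plain s)) (const⊛ (𝟙 (allowsUp s)) (pathSeries F (2 ℕ.+ h) rising) n))
                 (const⊛ (𝟙 (allowsRed s)) (pathSeries F h (fall red s)) n))

pathSeries-zero : ∀ F s → pathSeries F 0 s ≋ const (𝟙 (stops F s)) ⊕ const (𝟙 (rises F s)) ⊛ (Z ⊛ pathSeries F 1 rising)
pathSeries-zero F s = ≈⇒≋ λ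
  { zero    → sym (trans (cong (_+_ (𝟙 (stops F s))) (const⊛ (𝟙 (rises F s)) (Z ⊛ pathSeries F 1 rising) 0))
                         (trans (cong (_+_ (𝟙 (stops F s))) (ℤₚ.*-zeroʳ (𝟙 (rises F s)))) (ℤₚ.+-identityʳ _)))
  ; (suc n) → sym (trans (ℤₚ.+-identityˡ _)
                         (trans (const⊛ (𝟙 (rises F s)) (Z ⊛ pathSeries F 1 rising) (suc n))
                                (cong (𝟙 (rises F s) *_) (Z⊛-suc (pathSeries F 1 rising) n)))) }

accepts : Floor → ℕ → State → List Step → Bool
accepts F zero    s []      = stops F s
accepts F (suc h) s []      = false
accepts F zero    s (U ∷ w) = rises F s ∧ accepts F 1 rising w
accepts F zero    s (D ∷ w) = false
accepts F zero    s (R ∷ w) = false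
accepts F (suc h) s (U ∷ w) = allowsUp s ∧ accepts F (2 ℕ.+ h) rising w
accepts F (suc h) s (D ∷ w) = accepts F h (fall plain s) w
accepts F (suc h) s (R ∷ w) = allowsRed s ∧ accepts F h (fall red s) w

sumOver : {A : Set} → List A → (A → ℤ) → ℤ
sumOver []       f = 0ℤ
sumOver (x ∷ xs) f = f x + sumOver xs f

sumOver-++ : ∀ {A : Set} (xs ys : List A) f → sumOver (xs ++ ys) f ≡ sumOver xs f + sumOver ys f
sumOver-++ []       ys f = sym (ℤₚ.+-identityˡ _)
sumOver-++ (x ∷ xs) ys f = trans (cong (_+_ (f x)) (sumOver-++ xs ys f)) (sym (ℤₚ.+-assoc (f x) _ _))

sumOver-concatMap : ∀ {A B : Set} (g : A → List B) xs f → sumOver (concatMap g xs) f ≡ sumOver xs (λ x → sumOver (g x) f)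
sumOver-concatMap g []       f = refl
sumOver-concatMap g (x ∷ xs) f = trans (sumOver-++ (g x) (concatMap g xs) f) (cong (_+_ (sumOver (g x) f)) (sumOver-concatMap g xs f))

sumOver-cong : ∀ {A : Set} (xs : List A) {f g} → (∀ x → f x ≡ g x) → sumOver xs f ≡ sumOver xs g
sumOver-cong []       f≡g = refl
sumOver-cong (x ∷ xs) f≡g = cong₂ _+_ (f≡g x) (sumOver-cong xs f≡g)

sumOver-+ : ∀ {A : Set} (xs : List A) f g → sumOver xs (λ x → f x + g x) ≡ sumOver xs f + sumOver xs g
sumOver-+ []       f g = refl
sumOver-+ (x ∷ xs) f g = trans (cong (_+_ (f x + g x)) (sumOver-+ xs f g)) (+-interchange (f x) (g x) _ _)

sumOver-scale : ∀ {A : Set} (xs : List A) α f → sumOver xs (λ x → α * f x) ≡ α * sumOver xs f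
sumOver-scale []       α f = sym (ℤₚ.*-zeroʳ α)
sumOver-scale (x ∷ xs) α f = trans (cong (_+_ (α * f x)) (sumOver-scale xs α f)) (sym (ℤₚ.*-distribˡ-+ α (f x) _))

sumOver-words-suc : ∀ n f →
  sumOver (words (suc n)) f ≡ sumOver (words n) (λ w → f (U ∷ w) + (f (D ∷ w) + (f (R ∷ w) + 0ℤ)))
sumOver-words-suc n f = sumOver-concatMap _ (words n) f

𝟙-∧ : ∀ a b → 𝟙 (a ∧ b) ≡ 𝟙 a * 𝟙 b
𝟙-∧ true  b = sym (ℤₚ.*-identityˡ (𝟙 b))
𝟙-∧ false b = refl

sumOver-accepts : ∀ F n h s → sumOver (words n) (λ w → 𝟙 (accepts F h s w)) ≡ paths F n h s
sumOver-accepts F zero    zero    s = ℤₚ.+-identityʳ _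
sumOver-accepts F zero    (suc h) s = refl
sumOver-accepts F (suc n) zero    s = begin
  sumOver (words (suc n)) (λ w → 𝟙 (accepts F 0 s w))
    ≡⟨ sumOver-words-suc n _ ⟩
  sumOver (words n) (λ w → 𝟙 (rises F s ∧ accepts F 1 rising w) + 0ℤ)
    ≡⟨ sumOver-cong (words n) (λ w → trans (ℤₚ.+-identityʳ _) (𝟙-∧ (rises F s) _)) ⟩
  sumOver (words n) (λ w → 𝟙 (rises F s) * 𝟙 (accepts F 1 rising w))
    ≡⟨ sumOver-scale (words n) (𝟙 (rises F s)) _ ⟩
  𝟙 (rises F s) * sumOver (words n) (λ w → 𝟙 (accepts F 1 rising w))
    ≡⟨ cong (𝟙 (rises F s) *_) (sumOver-accepts F n 1 rising) ⟩
  𝟙 (rises F s) * paths F n 1 rising ∎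
sumOver-accepts F (suc n) (suc h) s = begin
  sumOver (words (suc n)) (λ w → 𝟙 (accepts F (suc h) s w))
    ≡⟨ sumOver-words-suc n _ ⟩
  Σ (λ w → 𝟙 (allowsUp s ∧ up w) + (𝟙 (down plain w) + (𝟙 (allowsRed s ∧ down red w) + 0ℤ)))
    ≡⟨ sumOver-cong (words n) per-word ⟩
  Σ (λ w → u * 𝟙 (up w) + 𝟙 (down plain w) + v * 𝟙 (down red w))
    ≡⟨ trans (sumOver-+ (words n) _ _) (cong₂ _+_ (sumOver-+ (words n) _ _) (sumOver-scale (words n) v _)) ⟩
  Σ (λ w → u * 𝟙 (up w)) + Σ (𝟙 ∘ down plain) + v * Σ (𝟙 ∘ down red)
    ≡⟨ cong (λ x → x + Σ (𝟙 ∘ down plain) + v * Σ (𝟙 ∘ down red)) (sumOver-scale (words n) u _) ⟩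
  u * Σ (𝟙 ∘ up) + Σ (𝟙 ∘ down plain) + v * Σ (𝟙 ∘ down red)
    ≡⟨ cong₂ _+_ (cong₂ _+_ (cong (u *_) (sumOver-accepts F n (2 ℕ.+ h) rising))
                            (sumOver-accepts F n h (fall plain s)))
                 (cong (v *_) (sumOver-accepts F n h (fall red s))) ⟩
  paths F (suc n) (suc h) s ∎
  where
  u v : ℤ
  u = 𝟙 (allowsUp s)
  v = 𝟙 (allowsRed s)
  Σ : (List Step → ℤ) → ℤ
  Σ = sumOver (words n)
  up : List Step → Bool
  up = accepts F (2 ℕ.+ h) rising
  down : Colour → List Step → Bool
  down c = accepts F h (fall c s)
  per-word : ∀ w → 𝟙 (allowsUp s ∧ up w) + (𝟙 (down plain w) + (𝟙 (allowsRed s ∧ down red w) + 0ℤ))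
                 ≡ u * 𝟙 (up w) + 𝟙 (down plain w) + v * 𝟙 (down red w)
  per-word w = begin
    𝟙 (allowsUp s ∧ up w) + (𝟙 (down plain w) + (𝟙 (allowsRed s ∧ down red w) + 0ℤ))
      ≡⟨ cong₂ (λ x y → x + (𝟙 (down plain w) + y))
               (𝟙-∧ (allowsUp s) (up w)) (trans (ℤₚ.+-identityʳ _) (𝟙-∧ (allowsRed s) (down red w))) ⟩
    u * 𝟙 (up w) + (𝟙 (down plain w) + v * 𝟙 (down red w))
      ≡⟨ ℤₚ.+-assoc (u * 𝟙 (up w)) _ _ ⟨
    u * 𝟙 (up w) + 𝟙 (down plain w) + v * 𝟙 (down red w) ∎

-- From the axis a path may climb at the start or after an odd plain run (RU is forbidden and
-- even runs may not end on the axis); it may stop there after an odd run of its final colour.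
axisFloor : Colour → Floor
axisFloor c = record { rises = climbs ; stops = _== falling c true }
  where
  climbs : State → Bool
  climbs rising            = true
  climbs (falling plain p) = p
  climbs (falling red _)   = false

-- What `counted` demands of the rest w of a word that is at height h after a down-run of length k
-- ending with the step p (k = 0 and p = U after an up-step or at the start).
countedFrom : Colour → ℕ → ℕ → Step → List Step → Bool
countedFrom c h k p w =
  staysAbove h w ∧ (noUR-RU (p ∷ w) ∧ (oddRuns h k w ∧ (isZero (endHeight h w) ∧ lastIs (step c) (p ∷ w))))

data Tracks : ℕ → Step → State → Set where
  after-up   : Tracks 0 U rising
  after-down : ∀ c j → Tracks (suc j) (step c) (falling c (odd (suc j)))

not-odd-suc : ∀ j → not (odd (suc j)) ≡ odd j
not-odd-suc zero          = refl
not-odd-suc (suc zero)    = refl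
not-odd-suc (suc (suc j)) = not-odd-suc j

fall-tracks : ∀ c {k p s} → Tracks k p s → Tracks (suc k) (step c) (fall c s)
fall-tracks c after-up          = after-down c 0
fall-tracks c (after-down c′ j) =
  subst (λ q → Tracks (2 ℕ.+ j) (step c) (falling c q)) (sym (not-odd-suc j)) (after-down c (suc j))

lastIs-∷∷ : ∀ s p q w → lastIs s (p ∷ q ∷ w) ≡ lastIs s (q ∷ w)
lastIs-∷∷ U U _ _ = refl
lastIs-∷∷ U D _ _ = refl
lastIs-∷∷ U R _ _ = refl
lastIs-∷∷ D U _ _ = refl
lastIs-∷∷ D D _ _ = refl
lastIs-∷∷ D R _ _ = refl
lastIs-∷∷ R U _ _ = refl
lastIs-∷∷ R D _ _ = refl
lastIs-∷∷ R R _ _ = refl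

noUR-RU-∷D : ∀ p w → noUR-RU (p ∷ D ∷ w) ≡ noUR-RU (D ∷ w)
noUR-RU-∷D U w = refl
noUR-RU-∷D D w = refl
noUR-RU-∷D R w = refl

runOK-off-axis : ∀ h k → runOK (suc h) k ≡ true
runOK-off-axis h zero    = refl
runOK-off-axis h (suc k) = refl

countedFrom-U : ∀ c h w {k p s} → Tracks k p s →
  countedFrom c h k p (U ∷ w) ≡ allowsUp s ∧ (runOK h k ∧ countedFrom c (suc h) 0 U w)
countedFrom-U c h w after-up =
  cong (λ l → staysAbove (suc h) w ∧ (noUR-RU (U ∷ w) ∧ (oddRuns (suc h) 0 w ∧ (isZero (endHeight (suc h) w) ∧ l))))
       (lastIs-∷∷ (step c) U U w)
countedFrom-U c h w (after-down plain j) = begin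
  a ∧ (b ∧ ((g ∧ o) ∧ (z ∧ lastIs (step c) (D ∷ U ∷ w))))
    ≡⟨ cong (λ l → a ∧ (b ∧ ((g ∧ o) ∧ (z ∧ l)))) (lastIs-∷∷ (step c) D U w) ⟩
  a ∧ (b ∧ ((g ∧ o) ∧ (z ∧ lastIs (step c) (U ∷ w))))
    ≡⟨ pull-out g ⟩
  g ∧ countedFrom c (suc h) 0 U w ∎
  where
  a b g o z : Bool
  a = staysAbove (suc h) w
  b = noUR-RU (U ∷ w)
  g = runOK h (suc j)
  o = oddRuns (suc h) 0 w
  z = isZero (endHeight (suc h) w)
  pull-out : ∀ g → a ∧ (b ∧ ((g ∧ o) ∧ (z ∧ lastIs (step c) (U ∷ w)))) ≡ g ∧ countedFrom c (suc h) 0 U w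
  pull-out true  = refl
  pull-out false = trans (cong (a ∧_) (∧-zeroʳ b)) (∧-zeroʳ a)
countedFrom-U c h w (after-down red j) = ∧-zeroʳ (staysAbove (suc h) w)

countedFrom-D : ∀ c h k p w → countedFrom c (suc h) k p (D ∷ w) ≡ countedFrom c h (suc k) D w
countedFrom-D c h k p w =
  cong₂ (λ b l → staysAbove h w ∧ (b ∧ (oddRuns h (suc k) w ∧ (isZero (endHeight h w) ∧ l))))
        (noUR-RU-∷D p w) (lastIs-∷∷ (step c) p D w)

countedFrom-R : ∀ c h w {k p s} → Tracks k p s →
  countedFrom c (suc h) k p (R ∷ w) ≡ allowsRed s ∧ countedFrom c h (suc k) R w
countedFrom-R c h w after-up             = ∧-zeroʳ (staysAbove h w)
countedFrom-R c h w (after-down plain j) =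
  cong (λ l → staysAbove h w ∧ (noUR-RU (R ∷ w) ∧ (oddRuns h (2 ℕ.+ j) w ∧ (isZero (endHeight h w) ∧ l))))
       (lastIs-∷∷ (step c) D R w)
countedFrom-R c h w (after-down red j)   =
  cong (λ l → staysAbove h w ∧ (noUR-RU (R ∷ w) ∧ (oddRuns h (2 ℕ.+ j) w ∧ (isZero (endHeight h w) ∧ l))))
       (lastIs-∷∷ (step c) R R w)

accepts-tracks : ∀ c h {k p s} → Tracks k p s → ∀ w → accepts (axisFloor c) h s w ≡ countedFrom c h k p w
accepts-tracks plain zero    after-up                 [] = refl
accepts-tracks red   zero    after-up                 [] = refl
accepts-tracks plain zero    (after-down plain j)     [] = refl
accepts-tracks plain zero    (after-down red j)       [] = refl
accepts-tracks red   zero    (after-down plain j)     [] = refl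
accepts-tracks red   zero    (after-down red j)       [] = refl
accepts-tracks c     (suc h) after-up                 [] = refl
accepts-tracks c     (suc h) (after-down plain j)     [] = refl
accepts-tracks c     (suc h) (after-down red j)       [] = refl
accepts-tracks c zero {k} {p} {s} t (U ∷ w) = begin
  rises (axisFloor c) s ∧ accepts (axisFloor c) 1 rising w ≡⟨ cong₂ _∧_ (rises-tracks t) (accepts-tracks c 1 after-up w) ⟩
  (allowsUp s ∧ runOK 0 k) ∧ countedFrom c 1 0 U w          ≡⟨ ∧-assoc (allowsUp s) (runOK 0 k) _ ⟩
  allowsUp s ∧ (runOK 0 k ∧ countedFrom c 1 0 U w)          ≡⟨ countedFrom-U c 0 w t ⟨
  countedFrom c 0 k p (U ∷ w)                                ∎
  where
  rises-tracks : ∀ {k p s} → Tracks k p s → rises (axisFloor c) s ≡ allowsUp s ∧ runOK 0 k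
  rises-tracks after-up             = refl
  rises-tracks (after-down plain j) = refl
  rises-tracks (after-down red j)   = refl
accepts-tracks c (suc h) {k} {p} {s} t (U ∷ w) = begin
  allowsUp s ∧ accepts (axisFloor c) (2 ℕ.+ h) rising w
    ≡⟨ cong (allowsUp s ∧_) (accepts-tracks c (2 ℕ.+ h) after-up w) ⟩
  allowsUp s ∧ countedFrom c (2 ℕ.+ h) 0 U w
    ≡⟨ cong (λ g → allowsUp s ∧ (g ∧ _)) (runOK-off-axis h k) ⟨
  allowsUp s ∧ (runOK (suc h) k ∧ countedFrom c (2 ℕ.+ h) 0 U w)
    ≡⟨ countedFrom-U c (suc h) w t ⟨
  countedFrom c (suc h) k p (U ∷ w) ∎
accepts-tracks c zero    t (D ∷ w) = refl
accepts-tracks c (suc h) {k} {p} t (D ∷ w) =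
  trans (accepts-tracks c h (fall-tracks plain t) w) (sym (countedFrom-D c h k p w))
accepts-tracks c zero    t (R ∷ w) = refl
accepts-tracks c (suc h) {s = s} t (R ∷ w) =
  trans (cong (allowsRed s ∧_) (accepts-tracks c h (fall-tracks red t) w)) (sym (countedFrom-R c h w t))

counted-countedFrom : ∀ c w → counted (step c) w ≡ countedFrom c 0 0 U w
counted-countedFrom plain []      = refl
counted-countedFrom red   []      = refl
counted-countedFrom c     (U ∷ w) = begin
  (a ∧ (b ∧ o)) ∧ (z ∧ lastIs (step c) (U ∷ w)) ≡⟨ ∧-assoc a (b ∧ o) _ ⟩
  a ∧ ((b ∧ o) ∧ (z ∧ lastIs (step c) (U ∷ w))) ≡⟨ cong (a ∧_) (∧-assoc b o _) ⟩
  a ∧ (b ∧ (o ∧ (z ∧ lastIs (step c) (U ∷ w))))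
    ≡⟨ cong (λ l → a ∧ (b ∧ (o ∧ (z ∧ l)))) (lastIs-∷∷ (step c) U U w) ⟨
  countedFrom c 0 0 U (U ∷ w)                    ∎
  where
  a b o z : Bool
  a = staysAbove 1 w
  b = noUR-RU (U ∷ w)
  o = oddRuns 0 0 (U ∷ w)
  z = isZero (endHeight 1 w)
counted-countedFrom c     (D ∷ w) = refl
counted-countedFrom c     (R ∷ w) = refl

𝟙-filter : ∀ {A : Set} (P : A → Bool) xs → + length (filter (λ x → P x ≟ᵇ true) xs) ≡ sumOver xs (𝟙 ∘ P)
𝟙-filter P []       = refl
𝟙-filter P (x ∷ xs) with P x
... | true  = cong (_+_ 1ℤ) (𝟙-filter P xs)
... | false = trans (𝟙-filter P xs) (sym (ℤₚ.+-identityˡ _))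

countWith≈pathSeries : ∀ c → (λ n → + countWith (step c) n) ≈ pathSeries (axisFloor c) 0 rising
countWith≈pathSeries c n = begin
  + countWith (step c) n                                ≡⟨ 𝟙-filter (counted (step c)) (words n) ⟩
  sumOver (words n) (𝟙 ∘ counted (step c))               ≡⟨ sumOver-cong (words n) (cong 𝟙 ∘ counted≡accepts) ⟩
  sumOver (words n) (𝟙 ∘ accepts (axisFloor c) 0 rising) ≡⟨ sumOver-accepts (axisFloor c) n 0 rising ⟩
  paths (axisFloor c) n 0 rising                         ∎
  where
  counted≡accepts : ∀ w → counted (step c) w ≡ accepts (axisFloor c) 0 rising w
  counted≡accepts w = trans (counted-countedFrom c w) (sym (accepts-tracks c 0 after-up w))

-- Stated over an arbitrary carrier so that the same expressions also exist as solver polynomials.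
module Expansion {A : Set} (_+_ _*_ : A → A → A) (κ : ℤ → A) (z : A) (P : State → A) where

  fromLevel1 : State → State → A
  fromLevel1 ρ τ =
    z * (((κ (𝟙 (allowsUp ρ)) * P τ) + κ (𝟙 (fall plain ρ == τ))) + (κ (𝟙 (allowsRed ρ)) * κ (𝟙 (fall red ρ == τ))))

  fromLevel2 : State → A
  fromLevel2 τ = sumFalling _+_ (λ ρ → fromLevel1 rising ρ * fromLevel1 ρ τ)

  fromAxis : Floor → A → A
  fromAxis F y = z * sumFalling _+_ (λ τ → fromLevel1 rising τ * (κ (𝟙 (stops F τ)) + (κ (𝟙 (rises F τ)) * y)))

P : State → FPS
P τ = passage τ 2 rising

open Expansion _⊕_ _⊛_ const Z P

sumFalling-⊕-cong : ∀ {f g : State → FPS} → (∀ τ → f τ ≋ g τ) → sumFalling _⊕_ f ≋ sumFalling _⊕_ g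
sumFalling-⊕-cong f≋g = ⊕-cong (⊕-cong (⊕-cong (f≋g _) (f≋g _)) (f≋g _)) (f≋g _)

passage-fromLevel1 : ∀ ρ τ → passage τ 1 ρ ≋ fromLevel1 ρ τ
passage-fromLevel1 ρ τ = ≋-trans (pathSeries-suc (toAxis τ) 0 ρ)
  (⊛-cong ≋-refl (⊕-cong (⊕-cong (≋-refl {const (𝟙 (allowsUp ρ)) ⊛ P τ}) (≈⇒≋ (passage-zero τ (fall plain ρ))))
                          (⊛-cong (≋-refl {const (𝟙 (allowsRed ρ))}) (≈⇒≋ (passage-zero τ (fall red ρ))))))

P-fromLevel2 : ∀ τ → P τ ≋ fromLevel2 τ
P-fromLevel2 τ = ≋-trans (pathSeries-split (toAxis τ) 1 rising)
  (sumFalling-⊕-cong λ ρ → ⊛-cong (passage-fromLevel1 rising ρ) (passage-fromLevel1 ρ τ))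

module Syntax {n : ℕ} (z : Polynomial n) (p : State → Polynomial n) = Expansion _:+_ _:*_ con z p

-- The final run is plain (P) or red (Q), of even (⁰) or odd (¹) length.
P⁰ P¹ Q⁰ Q¹ : FPS
P⁰ = P (falling plain false)
P¹ = P (falling plain true)
Q⁰ = P (falling red false)
Q¹ = P (falling red true)

P-variables : ∀ {n} → Polynomial n → Polynomial n → Polynomial n → Polynomial n → State → Polynomial n
P-variables a b c d rising                = con 0ℤ
P-variables a b c d (falling plain false) = a
P-variables a b c d (falling plain true)  = b
P-variables a b c d (falling red false)   = c
P-variables a b c d (falling red true)    = d

P¹-split : P¹ ≋ Z ⊛ Z ⊛ (P⁰ ⊕ P¹ ⊕ 1#) ⊛ P¹ ⊕ Z ⊛ Z ⊛ (P⁰ ⊕ Q⁰)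
P¹-split = ≋-trans (P-fromLevel2 (falling plain true))
  (solve 5 (λ z a b c d → Syntax.fromLevel2 z (P-variables a b c d) (falling plain true)
                        := z :* z :* (a :+ b :+ con 1ℤ) :* b :+ z :* z :* (a :+ c)) ≋-refl Z P⁰ P¹ Q⁰ Q¹)

Q¹-split : Q¹ ≋ Z ⊛ Z ⊛ (P⁰ ⊕ P¹ ⊕ 1#) ⊛ Q¹ ⊕ Z ⊛ Z ⊛ (P⁰ ⊕ Q⁰)
Q¹-split = ≋-trans (P-fromLevel2 (falling red true))
  (solve 5 (λ z a b c d → Syntax.fromLevel2 z (P-variables a b c d) (falling red true)
                        := z :* z :* (a :+ b :+ con 1ℤ) :* d :+ z :* z :* (a :+ c)) ≋-refl Z P⁰ P¹ Q⁰ Q¹)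

P⁰-split : P⁰ ≋ Z ⊛ Z ⊛ (P⁰ ⊕ P¹ ⊕ 1#) ⊛ P⁰ ⊕ Z ⊛ Z ⊛ (P¹ ⊕ 1# ⊕ Q¹)
P⁰-split = ≋-trans (P-fromLevel2 (falling plain false))
  (solve 5 (λ z a b c d → Syntax.fromLevel2 z (P-variables a b c d) (falling plain false)
                        := z :* z :* (a :+ b :+ con 1ℤ) :* a :+ z :* z :* (b :+ con 1ℤ :+ d)) ≋-refl Z P⁰ P¹ Q⁰ Q¹)

Q⁰-split : Q⁰ ≋ Z ⊛ Z ⊛ (P⁰ ⊕ P¹ ⊕ 1#) ⊛ Q⁰ ⊕ Z ⊛ Z ⊛ (P¹ ⊕ 1# ⊕ Q¹)
Q⁰-split = ≋-trans (P-fromLevel2 (falling red false))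
  (solve 5 (λ z a b c d → Syntax.fromLevel2 z (P-variables a b c d) (falling red false)
                        := z :* z :* (a :+ b :+ con 1ℤ) :* c :+ z :* z :* (b :+ con 1ℤ :+ d)) ≋-refl Z P⁰ P¹ Q⁰ Q¹)

Q¹≋P¹ : Q¹ ≋ P¹
Q¹≋P¹ = cancel-linear-combination (1# ⊖ Z ⊛ Z ⊛ (P⁰ ⊕ P¹ ⊕ 1#)) (λ ())
  (1# · Q¹-split ∷ const (- 1ℤ) · P¹-split ∷ [])
  (solve 5 (λ z a b c d →
       (con 1ℤ :- z :* z :* (a :+ b :+ con 1ℤ)) :* (d :- b)
    := con 1ℤ :* (d :- (z :* z :* (a :+ b :+ con 1ℤ) :* d :+ z :* z :* (a :+ c)))
       :+ (con (- 1ℤ) :* (b :- (z :* z :* (a :+ b :+ con 1ℤ) :* b :+ z :* z :* (a :+ c))) :+ con 0ℤ))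
    ≋-refl Z P⁰ P¹ Q⁰ Q¹)

Q⁰≋P⁰ : Q⁰ ≋ P⁰
Q⁰≋P⁰ = cancel-linear-combination (1# ⊖ Z ⊛ Z ⊛ (P⁰ ⊕ P¹ ⊕ 1#)) (λ ())
  (1# · Q⁰-split ∷ const (- 1ℤ) · P⁰-split ∷ [])
  (solve 5 (λ z a b c d →
       (con 1ℤ :- z :* z :* (a :+ b :+ con 1ℤ)) :* (c :- a)
    := con 1ℤ :* (c :- (z :* z :* (a :+ b :+ con 1ℤ) :* c :+ z :* z :* (b :+ con 1ℤ :+ d)))
       :+ (con (- 1ℤ) :* (a :- (z :* z :* (a :+ b :+ con 1ℤ) :* a :+ z :* z :* (b :+ con 1ℤ :+ d))) :+ con 0ℤ))
    ≋-refl Z P⁰ P¹ Q⁰ Q¹)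

P¹-equation : P¹ ≋ Z ⊛ Z ⊛ (P⁰ ⊕ P¹ ⊕ 1#) ⊛ P¹ ⊕ const (+ 2) ⊛ (Z ⊛ Z) ⊛ P⁰
P¹-equation = linear-combination (1# · P¹-split ∷ Z ⊛ Z · Q⁰≋P⁰ ∷ [])
  (solve 4 (λ z a b c →
       b :- (z :* z :* (a :+ b :+ con 1ℤ) :* b :+ con (+ 2) :* (z :* z) :* a)
    := con 1ℤ :* (b :- (z :* z :* (a :+ b :+ con 1ℤ) :* b :+ z :* z :* (a :+ c))) :+ (z :* z :* (c :- a) :+ con 0ℤ))
    ≋-refl Z P⁰ P¹ Q⁰)

P⁰-equation : P⁰ ≋ Z ⊛ Z ⊛ (P⁰ ⊕ P¹ ⊕ 1#) ⊛ P⁰ ⊕ Z ⊛ Z ⊛ (1# ⊕ const (+ 2) ⊛ P¹)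
P⁰-equation = linear-combination (1# · P⁰-split ∷ Z ⊛ Z · Q¹≋P¹ ∷ [])
  (solve 4 (λ z a b d →
       a :- (z :* z :* (a :+ b :+ con 1ℤ) :* a :+ z :* z :* (con 1ℤ :+ con (+ 2) :* b))
    := con 1ℤ :* (a :- (z :* z :* (a :+ b :+ con 1ℤ) :* a :+ z :* z :* (b :+ con 1ℤ :+ d))) :+ (z :* z :* (d :- b) :+ con 0ℤ))
    ≋-refl Z P⁰ P¹ Q¹)

P¹-P⁰-relation : P¹ ⊕ const (+ 2) ⊛ P¹ ⊛ P¹ ≋ const (+ 2) ⊛ P⁰ ⊛ P⁰
P¹-P⁰-relation = ≋0⇒≋ (Z⊛X≋0⇒X≋0 (Z⊛X≋0⇒X≋0 (≋-trans
  (solve 3 (λ z a b →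
       z :* (z :* (b :+ con (+ 2) :* b :* b :- con (+ 2) :* a :* a))
    := a :* (b :- (z :* z :* (a :+ b :+ con 1ℤ) :* b :+ con (+ 2) :* (z :* z) :* a))
       :+ ((:- b) :* (a :- (z :* z :* (a :+ b :+ con 1ℤ) :* a :+ z :* z :* (con 1ℤ :+ con (+ 2) :* b))) :+ con 0ℤ))
    ≋-refl Z P⁰ P¹)
  (linear-combination-≋0 (P⁰ · P¹-equation ∷ ⊝ P¹ · P⁰-equation ∷ [])))))

IsRoot : FPS → Set
IsRoot X = Z ⊛ X ⊛ X ⊕ const (+ 2) ⊛ Z ≋ (1# ⊕ Z ⊛ Z) ⊛ X ⊕ Z ⊛ Z ⊛ Z

-- (X − Y)(Z (X + Y) − 1 − Z²) vanishes, and its second factor has constant term −1.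
roots-unique : ∀ {X Y} → IsRoot X → IsRoot Y → X ≋ Y
roots-unique {X} {Y} X-root Y-root = cancel-linear-combination (Z ⊛ (X ⊕ Y) ⊖ 1# ⊖ Z ⊛ Z) (λ ())
  (1# · X-root ∷ const (- 1ℤ) · Y-root ∷ [])
  (solve 3 (λ z x y →
       (z :* (x :+ y) :- con 1ℤ :- z :* z) :* (x :- y)
    := con 1ℤ :* (z :* x :* x :+ con (+ 2) :* z :- ((con 1ℤ :+ z :* z) :* x :+ z :* z :* z))
       :+ (con (- 1ℤ) :* (z :* y :* y :+ con (+ 2) :* z :- ((con 1ℤ :+ z :* z) :* y :+ z :* z :* z)) :+ con 0ℤ))
    ≋-refl Z X Y)

r : FPS
r = Z ⊛ (const (+ 2) ⊕ P⁰ ⊕ P¹)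

r-root : IsRoot r
r-root = linear-combination (⊝ Z · P¹-equation ∷ ⊝ Z · P⁰-equation ∷ [])
  (solve 3 (λ z a b →
       z :* (z :* (con (+ 2) :+ a :+ b)) :* (z :* (con (+ 2) :+ a :+ b)) :+ con (+ 2) :* z
         :- ((con 1ℤ :+ z :* z) :* (z :* (con (+ 2) :+ a :+ b)) :+ z :* z :* z)
    := (:- z) :* (b :- (z :* z :* (a :+ b :+ con 1ℤ) :* b :+ con (+ 2) :* (z :* z) :* a))
       :+ ((:- z) :* (a :- (z :* z :* (a :+ b :+ con 1ℤ) :* a :+ z :* z :* (con 1ℤ :+ con (+ 2) :* b))) :+ con 0ℤ))
    ≋-refl Z P⁰ P¹)

radical-root : ∀ {S X} →
  S ⊛ S ≋ const (+ 1) ⊖ const (+ 6) ⊛ Z ⊛ Z ⊕ const (+ 5) ⊛ Z ⊛ Z ⊛ Z ⊛ Z →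
  const (+ 2) ⊛ Z ⊛ X ≋ const (+ 1) ⊕ Z ⊛ Z ⊖ S → IsRoot X
radical-root {S} {X} S² X-def = ≋0⇒≋ (Z⊛X≋0⇒X≋0 (u⊛X≋0⇒X≋0 {const (+ 4)} (λ ()) (≋-trans
  (solve 3 (λ z x s →
       con (+ 4) :* (z :* (z :* x :* x :+ con (+ 2) :* z :- ((con 1ℤ :+ z :* z) :* x :+ z :* z :* z)))
    := (con (+ 2) :* z :* x :- (con 1ℤ :+ z :* z) :- s) :* (con (+ 2) :* z :* x :- (con (+ 1) :+ z :* z :- s))
       :+ (con 1ℤ :* (s :* s :- (con (+ 1) :- con (+ 6) :* z :* z :+ con (+ 5) :* z :* z :* z :* z)) :+ con 0ℤ))
    ≋-refl Z X S)
  (linear-combination-≋0 (const (+ 2) ⊛ Z ⊛ X ⊖ (1# ⊕ Z ⊛ Z) ⊖ S · X-def ∷ 1# · S² ∷ [])))))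

Y : Colour → FPS
Y c = Z ⊛ pathSeries (axisFloor c) 1 rising

countWith≋Y : ∀ c → (λ n → + countWith (step c) n) ≋ Y c
countWith≋Y c = ≋-trans (≈⇒≋ (countWith≈pathSeries c))
  (≋-trans (pathSeries-zero (axisFloor c) rising) (solve 1 (λ y → con 0ℤ :+ con 1ℤ :* y := y) ≋-refl (Y c)))

Y-fromAxis : ∀ c → Y c ≋ fromAxis (axisFloor c) (Y c)
Y-fromAxis c = ⊛-cong ≋-refl (≋-trans (pathSeries-split (axisFloor c) 0 rising)
  (sumFalling-⊕-cong λ τ → ⊛-cong (passage-fromLevel1 rising τ) (pathSeries-zero (axisFloor c) τ)))

Y-plain : Y plain ≋ Z ⊛ Z ⊛ (P¹ ⊕ 1#) ⊛ (1# ⊕ Y plain)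
Y-plain = ≋-trans (Y-fromAxis plain)
  (solve 6 (λ z a b c d y → Syntax.fromAxis z (P-variables a b c d) (axisFloor plain) y
                          := z :* z :* (b :+ con 1ℤ) :* (con 1ℤ :+ y)) ≋-refl Z P⁰ P¹ Q⁰ Q¹ (Y plain))

Y-red : Y red ≋ Z ⊛ Z ⊛ Q¹ ⊕ Z ⊛ Z ⊛ (P¹ ⊕ 1#) ⊛ Y red
Y-red = ≋-trans (Y-fromAxis red)
  (solve 6 (λ z a b c d y → Syntax.fromAxis z (P-variables a b c d) (axisFloor red) y
                          := z :* z :* d :+ z :* z :* (b :+ con 1ℤ) :* y) ≋-refl Z P⁰ P¹ Q⁰ Q¹ (Y red))

-- Y plain and Y red have the denominator 1 − Z²(1 + P¹), which both formulas cancel.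
h₀-formula : ∀ {r₂} → r₂ ≋ r →
  h₀ ⊛ (Z ⊛ Z ⊖ const (+ 2)) ⊛ (const (+ 1) ⊕ Z ⊛ Z)
    ≋ ⊝ ((Z ⊛ Z ⊛ Z ⊖ const (+ 2) ⊛ Z ⊕ const (+ 2) ⊛ r₂) ⊛ Z)
h₀-formula {r₂} r₂≋r = cancel-linear-combination (1# ⊖ Z ⊛ Z ⊖ Z ⊛ Z ⊛ P¹) (λ ())
  ( (Z ⊛ Z ⊖ const (+ 2)) ⊛ (1# ⊕ Z ⊛ Z) ⊛ (1# ⊖ Z ⊛ Z ⊖ Z ⊛ Z ⊛ P¹) · countWith≋Y plain
  ∷ (Z ⊛ Z ⊖ const (+ 2)) ⊛ (1# ⊕ Z ⊛ Z) · Y-plain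
  ∷ const (+ 2) ⊛ (Z ⊛ Z) · P⁰-equation
  ∷ ⊝ (Z ⊛ Z ⊛ (Z ⊛ Z)) · P¹-P⁰-relation
  ∷ const (+ 2) ⊛ Z ⊛ (1# ⊖ Z ⊛ Z ⊖ Z ⊛ Z ⊛ P¹) · r₂≋r
  ∷ [])
  (solve 6 (λ z a b h y t →
       (con 1ℤ :- z :* z :- z :* z :* b) :* (h :* (z :* z :- con (+ 2)) :* (con (+ 1) :+ z :* z)
         :- :- ((z :* z :* z :- con (+ 2) :* z :+ con (+ 2) :* t) :* z))
    := (z :* z :- con (+ 2)) :* (con 1ℤ :+ z :* z) :* (con 1ℤ :- z :* z :- z :* z :* b) :* (h :- y)
       :+ ((z :* z :- con (+ 2)) :* (con 1ℤ :+ z :* z) :* (y :- z :* z :* (b :+ con 1ℤ) :* (con 1ℤ :+ y))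
       :+ (con (+ 2) :* (z :* z) :* (a :- (z :* z :* (a :+ b :+ con 1ℤ) :* a :+ z :* z :* (con 1ℤ :+ con (+ 2) :* b)))
       :+ ((:- (z :* z :* (z :* z))) :* (b :+ con (+ 2) :* b :* b :- con (+ 2) :* a :* a)
       :+ (con (+ 2) :* z :* (con 1ℤ :- z :* z :- z :* z :* b) :* (t :- z :* (con (+ 2) :+ a :+ b))
       :+ con 0ℤ))))) ≋-refl Z P⁰ P¹ h₀ (Y plain) r₂)

k₀-formula : ∀ {r₂} → r₂ ≋ r →
  k₀ ⊛ (Z ⊛ Z ⊖ const (+ 2)) ⊛ (const (+ 1) ⊕ Z ⊛ Z)
    ≋ const (+ 2) ⊛ ((⊝ (Z ⊛ Z ⊛ Z) ⊕ r₂ ⊛ Z ⊛ Z ⊕ const (+ 2) ⊛ Z ⊖ r₂) ⊛ Z)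
k₀-formula {r₂} r₂≋r = cancel-linear-combination (1# ⊖ Z ⊛ Z ⊖ Z ⊛ Z ⊛ P¹) (λ ())
  ( (Z ⊛ Z ⊖ const (+ 2)) ⊛ (1# ⊕ Z ⊛ Z) ⊛ (1# ⊖ Z ⊛ Z ⊖ Z ⊛ Z ⊛ P¹) · countWith≋Y red
  ∷ (Z ⊛ Z ⊖ const (+ 2)) ⊛ (1# ⊕ Z ⊛ Z) · Y-red
  ∷ (Z ⊛ Z ⊖ const (+ 2)) ⊛ (1# ⊕ Z ⊛ Z) ⊛ (Z ⊛ Z) · Q¹≋P¹
  ∷ const (+ 2) ⊛ (Z ⊛ Z) ⊛ (1# ⊖ Z ⊛ Z) · P⁰-equation
  ∷ ⊝ (Z ⊛ Z ⊛ (Z ⊛ Z) ⊛ (1# ⊖ Z ⊛ Z)) · P¹-P⁰-relation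
  ∷ const (+ 2) ⊛ Z ⊛ (1# ⊖ Z ⊛ Z) ⊛ (1# ⊖ Z ⊛ Z ⊖ Z ⊛ Z ⊛ P¹) · r₂≋r
  ∷ [])
  (solve 7 (λ z a b d k y t →
       (con 1ℤ :- z :* z :- z :* z :* b) :* (k :* (z :* z :- con (+ 2)) :* (con (+ 1) :+ z :* z)
         :- con (+ 2) :* ((:- (z :* z :* z) :+ t :* z :* z :+ con (+ 2) :* z :- t) :* z))
    := (z :* z :- con (+ 2)) :* (con 1ℤ :+ z :* z) :* (con 1ℤ :- z :* z :- z :* z :* b) :* (k :- y)
       :+ ((z :* z :- con (+ 2)) :* (con 1ℤ :+ z :* z) :* (y :- (z :* z :* d :+ z :* z :* (b :+ con 1ℤ) :* y))
       :+ ((z :* z :- con (+ 2)) :* (con 1ℤ :+ z :* z) :* (z :* z) :* (d :- b)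
       :+ (con (+ 2) :* (z :* z) :* (con 1ℤ :- z :* z)
            :* (a :- (z :* z :* (a :+ b :+ con 1ℤ) :* a :+ z :* z :* (con 1ℤ :+ con (+ 2) :* b)))
       :+ ((:- (z :* z :* (z :* z) :* (con 1ℤ :- z :* z))) :* (b :+ con (+ 2) :* b :* b :- con (+ 2) :* a :* a)
       :+ (con (+ 2) :* z :* (con 1ℤ :- z :* z) :* (con 1ℤ :- z :* z :- z :* z :* b) :* (t :- z :* (con (+ 2) :+ a :+ b))
       :+ con 0ℤ)))))) ≋-refl Z P⁰ P¹ Q¹ k₀ (Y red) r₂)

mainTheorem3 : (S : FPS) → S 0 ≡ + 1 →
    S ⊛ S ≈ const (+ 1) ⊖ const (+ 6) ⊛ Z ⊛ Z ⊕ const (+ 5) ⊛ Z ⊛ Z ⊛ Z ⊛ Z →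
    (r₂ : FPS) →
    const (+ 2) ⊛ Z ⊛ r₂ ≈ const (+ 1) ⊕ Z ⊛ Z ⊖ S →
    (h₀ ⊛ (Z ⊛ Z ⊖ const (+ 2)) ⊛ (const (+ 1) ⊕ Z ⊛ Z)
       ≈ ⊝ ((Z ⊛ Z ⊛ Z ⊖ const (+ 2) ⊛ Z ⊕ const (+ 2) ⊛ r₂) ⊛ Z))
    × (k₀ ⊛ (Z ⊛ Z ⊖ const (+ 2)) ⊛ (const (+ 1) ⊕ Z ⊛ Z)
       ≈ const (+ 2) ⊛ ((⊝ (Z ⊛ Z ⊛ Z) ⊕ r₂ ⊛ Z ⊛ Z ⊕ const (+ 2) ⊛ Z ⊖ r₂) ⊛ Z))
mainTheorem3 S _ S² r₂ r₂-def = ≋⇒≈ (h₀-formula r₂≋r) , ≋⇒≈ (k₀-formula r₂≋r)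
  where
  r₂≋r : r₂ ≋ r
  r₂≋r = roots-unique (radical-root (≈⇒≋ S²) (≈⇒≋ r₂-def)) r-root
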